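{- Let $A$ be a finite set of atoms and $P$ a propositional Horn theory over $A$. Then the least model of $P$ satisfies $$LM(P)=P^\omega,$$ where $P^\omega=P^+\circ\emptyset$ (equivalently, the set of facts of $P^+$), $P^+=P^\ast\circ P$ and $P^\ast=\bigcup_{n\ge0}P^n$.
   Context: A theory over $A$ is a finite set of rules $a_0\leftarrow a_1,\ldots,a_k$ ($k\ge0$, $a_i\in A$), with $head(r)=\{a_0\}$, $body(r)=\{a_1,\ldots,a_k\}$, size $k$; for a set $S$ of rules $head(S),body(S)$ are the unions of heads and bodies. A fact is a rule with empty body; interpretations (subsets of $A$) are identified with theories consisting of facts. Write $S\subseteq_r R$ if $S\subseteq R$ has as many elements as the size of $r$. Composition: $P\circ R=\{head(r)\leftarrow body(S)\mid r\in P,\ S\subseteq_r R,\ head(S)=body(r)\}$. Powers: $P^0=1_A=\{a\leftarrow a\mid a\in A\}$ and $P^{n+1}=P^n\circ P$. An interpretation $I$ is a model of $P$ if for every rule $r\in P$, $body(r)\subseteq I$ implies $head(r)\subseteq I$; $LM(P)$ is the least model of $P$ with respect to set inclusion. -}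

module Defs where

open import Data.Nat using (ℕ; zero; suc)
open import Data.Fin using (Fin)
open import Data.Fin.Subset as Sub using (Subset; ⁅_⁆; _∪_; ∣_∣; _⊆_)
open import Data.List using (List; []; _∷_; length; foldr)
open import Data.List.Membership.Propositional using () renaming (_∈_ to _∈ₗ_)
open import Data.List.Relation.Unary.All using (All)
open import Data.List.Relation.Unary.Unique.Propositional using (Unique)
open import Data.Product using (Σ; _×_; _,_; proj₁; proj₂)
open import Data.Empty using (⊥)
open import Relation.Binary.PropositionalEquality using (_≡_)
open import Function.Bundles using (_⇔_)

-- Atoms: A = Fin n (an arbitrary finite set of atoms).
-- A rule  a₀ ← a₁,…,aₖ  is a pair (head atom, body set).
Rule : ℕ → Set
Rule n = Fin n × Subset n

head : ∀ {n} → Rule n → Fin n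
head = proj₁

body : ∀ {n} → Rule n → Subset n
body = proj₂

size : ∀ {n} → Rule n → ℕ
size r = ∣ body r ∣

-- A (possibly infinite) set of rules, used for P^n, P*, P+, Pω.
Theory : ℕ → Set₁
Theory n = Rule n → Set

FinTheory : ℕ → Set
FinTheory n = List (Rule n)

⟦_⟧ : ∀ {n} → FinTheory n → Theory n
⟦ P ⟧ r = r ∈ₗ P

heads : ∀ {n} → List (Rule n) → Subset n
heads = foldr (λ r s → ⁅ head r ⁆ ∪ s) Sub.⊥

bodies : ∀ {n} → List (Rule n) → Subset n
bodies = foldr (λ r s → body r ∪ s) Sub.⊥

-- Composition  P ∘ R = { head(r) ← body(S) | r ∈ P, S ⊆_r R, head(S) = body(r) }
-- S ⊆_r R : S a finite subset of R with exactly size(r) elements.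
_∘_ : ∀ {n} → Theory n → Theory n → Theory n
(P ∘ R) (h , B) =
  Σ (Rule _) λ r → P r × head r ≡ h ×
    Σ (List (Rule _)) λ S → Unique S × All R S × length S ≡ size r ×
      heads S ≡ body r × bodies S ≡ B

𝟙 : ∀ {n} → Theory n
𝟙 (h , B) = B ≡ ⁅ h ⁆

∅ : ∀ {n} → Theory n
∅ _ = ⊥

_^_ : ∀ {n} → Theory n → ℕ → Theory n
P ^ zero = 𝟙
P ^ suc k = (P ^ k) ∘ P

_⋆ : ∀ {n} → Theory n → Theory n
(P ⋆) r = Σ ℕ λ k → (P ^ k) r

_⁺ : ∀ {n} → Theory n → Theory n
P ⁺ = (P ⋆) ∘ P

_^ω : ∀ {n} → Theory n → Theory n
P ^ω = (P ⁺) ∘ ∅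

-- Interpretations are subsets of A, identified with theories of facts.
Interpretation : ℕ → Set
Interpretation n = Subset n

asTheory : ∀ {n} → Interpretation n → Theory n
asTheory I (h , B) = (h Sub.∈ I) × (B ≡ Sub.⊥)

IsModel : ∀ {n} → FinTheory n → Interpretation n → Set
IsModel P I = ∀ r → r ∈ₗ P → body r ⊆ I → head r Sub.∈ I

IsLeastModel : ∀ {n} → FinTheory n → Interpretation n → Set
IsLeastModel P I = IsModel P I × (∀ J → IsModel P J → I ⊆ J)

_≐_ : ∀ {n} → Theory n → Theory n → Set
P ≐ Q = ∀ r → P r ⇔ Q r

module Submission where

-- Every model of P is closed under the rules of each power P^k, so it contains every fact
-- of P^ω. Conversely, forward chaining computes the least model and records for each
-- derived atom the rule of P that derived it and the step at which it did (its rank).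
-- Starting from h ← h in P^0 and repeatedly replacing every body atom by the body of its
-- recorded rule yields rules h ← X_k of P^k whose atoms have rank at most rank h − k;
-- hence X_k is empty for k = rank h + 1, and h ← ∅ is a fact of P^ω.

open import Defs
open import Data.Nat using (ℕ)
open import Data.Product using (Σ; _×_)

open import Data.Nat using (zero; suc; _+_; _≤_; _<_; z≤n)
open import Data.Nat.Properties
  using (≤-refl; ≤-trans; ≤-<-trans; <-≤-trans; m<n⇒m<1+n; n≮n; m+n≤o⇒m≤o; +-monoʳ-<)
open import Data.Product using (_,_; ∃)
open import Data.Sum using (_⊎_; inj₁; inj₂)
open import Data.Empty using (⊥-elim)
open import Data.Fin using (Fin; zero; suc; _≟_)
open import Data.Fin.Properties using (suc-injective)
open import Data.Fin.Subset as Sub using (Subset; ⁅_⁆; _∪_; ∣_∣; _⊆_; _⊂_; _∉_; inside; outside)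
open import Data.Fin.Subset.Properties
  using (_∈?_; _⊆?_; ∉⊥; ⊥⊆; ∣⊥∣≡0; ∣p∣≤n; x∈⁅x⁆; x∈⁅y⁆⇒x≡y; x∈p∪q⁺; x∈p∪q⁻; q⊆p∪q;
         ⊆-antisym; Empty-unique; p⊂q⇒∣p∣<∣q∣)
open import Data.Vec using (_∷_; []; here; there)
open import Data.List using (List; []; _∷_; length; map)
open import Data.List.Properties using (length-map)
open import Data.List.Relation.Unary.Any using (here; there)
open import Data.List.Relation.Unary.All as All using (All; []; _∷_)
open import Data.List.Relation.Unary.AllPairs using ([]; _∷_)
open import Data.List.Relation.Unary.Unique.Propositional using (Unique)
open import Data.List.Relation.Unary.Unique.Propositional.Properties using (map⁺)
open import Data.List.Membership.Propositional using () renaming (_∈_ to _∈ₗ_)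
open import Data.List.Membership.Propositional.Properties using (∈-map⁺; ∈-map⁻)
open import Relation.Binary.PropositionalEquality using (_≡_; _≢_; refl; sym; trans; cong; subst)
open import Relation.Nullary using (yes; no)
open import Function.Bundles using (mk⇔)

private
  variable
    n : ℕ

_∈_ : Fin n → Subset n → Set
_∈_ = Sub._∈_

∈-heads⁺ : ∀ {r : Rule n} {S} → r ∈ₗ S → head r ∈ heads S
∈-heads⁺ {r = r} (here refl) = x∈p∪q⁺ (inj₁ (x∈⁅x⁆ (head r)))
∈-heads⁺ (there r∈S) = x∈p∪q⁺ (inj₂ (∈-heads⁺ r∈S))

∈-heads⁻ : ∀ S {x : Fin n} → x ∈ heads S → ∃ λ r → r ∈ₗ S × head r ≡ x
∈-heads⁻ [] x∈ = ⊥-elim (∉⊥ x∈)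
∈-heads⁻ (r ∷ S) x∈ with x∈p∪q⁻ ⁅ head r ⁆ (heads S) x∈
... | inj₁ x∈⁅h⁆ = r , here refl , sym (x∈⁅y⁆⇒x≡y (head r) x∈⁅h⁆)
... | inj₂ x∈hs with ∈-heads⁻ S x∈hs
...   | r′ , r′∈S , eq = r′ , there r′∈S , eq

∈-bodies⁺ : ∀ {r : Rule n} {S x} → r ∈ₗ S → x ∈ body r → x ∈ bodies S
∈-bodies⁺ (here refl) x∈ = x∈p∪q⁺ (inj₁ x∈)
∈-bodies⁺ (there r∈S) x∈ = x∈p∪q⁺ (inj₂ (∈-bodies⁺ r∈S x∈))

∈-bodies⁻ : ∀ S {x : Fin n} → x ∈ bodies S → ∃ λ r → r ∈ₗ S × x ∈ body r
∈-bodies⁻ [] x∈ = ⊥-elim (∉⊥ x∈)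
∈-bodies⁻ (r ∷ S) x∈ with x∈p∪q⁻ (body r) (bodies S) x∈
... | inj₁ x∈b = r , here refl , x∈b
... | inj₂ x∈bs with ∈-bodies⁻ S x∈bs
...   | r′ , r′∈S , x∈b = r′ , there r′∈S , x∈b

fact∈∘ : ∀ {n} {T R : Theory n} {h} → T (h , Sub.⊥) → (T ∘ R) (h , Sub.⊥)
fact∈∘ {n} t = _ , t , refl , [] , [] , [] , sym (∣⊥∣≡0 n) , refl , refl

∘∅-body : ∀ {T : Theory n} {h B} → (T ∘ ∅) (h , B) → B ≡ Sub.⊥
∘∅-body (_ , _ , _ , [] , _ , _ , _ , _ , refl) = refl
∘∅-body (_ , _ , _ , _ ∷ _ , _ , () ∷ _ , _)

_⊨_ : Subset n → Theory n → Set
J ⊨ T = ∀ {h B} → T (h , B) → B ⊆ J → h ∈ J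

IsModel⇒⊨ : ∀ {P : FinTheory n} {J} → IsModel P J → J ⊨ ⟦ P ⟧
IsModel⇒⊨ model {h} {B} = model (h , B)

⊨-𝟙 : ∀ {J : Subset n} → J ⊨ 𝟙
⊨-𝟙 {h = h} refl ⁅h⁆⊆J = ⁅h⁆⊆J (x∈⁅x⁆ h)

⊨-∅ : ∀ {J : Subset n} → J ⊨ ∅
⊨-∅ ()

⊨-∘ : ∀ {J} {T R : Theory n} → J ⊨ T → J ⊨ R → J ⊨ (T ∘ R)
⊨-∘ {J = J} J⊨T J⊨R (_ , t , refl , S , _ , S⊆R , _ , refl , refl) bodies⊆J =
  J⊨T t λ x∈heads → case (∈-heads⁻ S x∈heads)
  where
  case : ∀ {x} → (∃ λ r → r ∈ₗ S × head r ≡ x) → x ∈ J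
  case (r , r∈S , refl) = J⊨R (All.lookup S⊆R r∈S) (λ y∈ → bodies⊆J (∈-bodies⁺ r∈S y∈))

⊨-^ : ∀ {J} {T : Theory n} → J ⊨ T → ∀ k → J ⊨ (T ^ k)
⊨-^ J⊨T zero = ⊨-𝟙
⊨-^ J⊨T (suc k) = ⊨-∘ (⊨-^ J⊨T k) J⊨T

⊨-⋆ : ∀ {J} {T : Theory n} → J ⊨ T → J ⊨ (T ⋆)
⊨-⋆ J⊨T (k , t) = ⊨-^ J⊨T k t

^ω-sound : ∀ {P : FinTheory n} {J h B} → IsModel P J → (⟦ P ⟧ ^ω) (h , B) → asTheory J (h , B)
^ω-sound model fact with ∘∅-body fact
... | refl = ⊨-∘ (⊨-∘ (⊨-⋆ J⊨P) J⊨P) ⊨-∅ fact ⊥⊆ , refl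
  where J⊨P = IsModel⇒⊨ model

elems : Subset n → List (Fin n)
elems [] = []
elems (inside ∷ p) = zero ∷ map suc (elems p)
elems (outside ∷ p) = map suc (elems p)

length-elems : ∀ (p : Subset n) → length (elems p) ≡ ∣ p ∣
length-elems [] = refl
length-elems (inside ∷ p) = cong suc (trans (length-map suc (elems p)) (length-elems p))
length-elems (outside ∷ p) = trans (length-map suc (elems p)) (length-elems p)

∈-elems⁺ : ∀ {p : Subset n} {x} → x ∈ p → x ∈ₗ elems p
∈-elems⁺ {p = inside ∷ p} here = here refl
∈-elems⁺ {p = inside ∷ p} (there x∈p) = there (∈-map⁺ suc (∈-elems⁺ x∈p))
∈-elems⁺ {p = outside ∷ p} (there x∈p) = ∈-map⁺ suc (∈-elems⁺ x∈p)

∈-elems⁻ : ∀ (p : Subset n) {x} → x ∈ₗ elems p → x ∈ p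
∈-elems⁻ (inside ∷ p) (here refl) = here
∈-elems⁻ (inside ∷ p) (there x∈) with ∈-map⁻ suc x∈
... | _ , y∈ , refl = there (∈-elems⁻ p y∈)
∈-elems⁻ (outside ∷ p) x∈ with ∈-map⁻ suc x∈
... | _ , y∈ , refl = there (∈-elems⁻ p y∈)

elems-unique : ∀ (p : Subset n) → Unique (elems p)
elems-unique [] = []
elems-unique (inside ∷ p) = All.tabulate zero∉ ∷ map⁺ suc-injective (elems-unique p)
  where
  zero∉ : ∀ {x} → x ∈ₗ map suc (elems p) → zero ≢ x
  zero∉ x∈ with ∈-map⁻ suc x∈
  ... | _ , _ , refl = λ ()
elems-unique (outside ∷ p) = map⁺ suc-injective (elems-unique p)

record RankedSupport (P : FinTheory n) (I : Subset n) : Set where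
  field
    rule : Fin n → Rule n
    rank : Fin n → ℕ
    head-rule : ∀ a → head (rule a) ≡ a
    rule∈P : ∀ {a} → a ∈ I → rule a ∈ₗ P
    body-rule⊆ : ∀ {a} → a ∈ I → body (rule a) ⊆ I
    rank-body< : ∀ {a b} → a ∈ I → b ∈ body (rule a) → rank b < rank a

module _ {n} {P : FinTheory n} {I : Subset n} (support : RankedSupport P I) where
  open RankedSupport support

  premises : Subset n → List (Rule n)
  premises X = map rule (elems X)

  rule-injective : ∀ {a b} → rule a ≡ rule b → a ≡ b
  rule-injective {a} {b} eq = trans (sym (head-rule a)) (trans (cong head eq) (head-rule b))

  heads-premises : ∀ X → heads (premises X) ≡ X
  heads-premises X = ⊆-antisym heads⊆X X⊆heads
    where
    heads⊆X : heads (premises X) ⊆ X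
    heads⊆X x∈ with ∈-heads⁻ (premises X) x∈
    ... | _ , r∈ , refl with ∈-map⁻ rule r∈
    ...   | a , a∈ , refl = subst (_∈ X) (sym (head-rule a)) (∈-elems⁻ X a∈)
    X⊆heads : X ⊆ heads (premises X)
    X⊆heads {x} x∈X = subst (_∈ heads (premises X)) (head-rule x) (∈-heads⁺ (∈-map⁺ rule (∈-elems⁺ x∈X)))

  ∈-bodies-premises⁻ : ∀ {X b} → b ∈ bodies (premises X) → ∃ λ a → a ∈ X × b ∈ body (rule a)
  ∈-bodies-premises⁻ {X = X} b∈ with ∈-bodies⁻ (premises X) b∈
  ... | _ , r∈ , b∈r with ∈-map⁻ rule r∈
  ...   | a , a∈ , refl = a , ∈-elems⁻ X a∈ , b∈r

  premises⊆P : ∀ {X} → X ⊆ I → All ⟦ P ⟧ (premises X)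
  premises⊆P {X = X} X⊆I = All.tabulate λ r∈ → case (∈-map⁻ rule r∈)
    where
    case : ∀ {r} → (∃ λ a → a ∈ₗ elems X × r ≡ rule a) → r ∈ₗ P
    case (a , a∈ , refl) = rule∈P (X⊆I (∈-elems⁻ X a∈))

  ^-suc-premises : ∀ {h X} k → (⟦ P ⟧ ^ k) (h , X) → X ⊆ I → (⟦ P ⟧ ^ suc k) (h , bodies (premises X))
  ^-suc-premises {h = h} {X = X} k t X⊆I =
    (h , X) , t , refl , premises X , map⁺ rule-injective (elems-unique X) , premises⊆P X⊆I ,
    trans (length-map rule (elems X)) (length-elems X) , heads-premises X , refl

  unfold : ∀ {h} → h ∈ I → ∀ k →
    ∃ λ X → (⟦ P ⟧ ^ k) (h , X) × X ⊆ I × (∀ {b} → b ∈ X → k + rank b ≤ rank h)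
  unfold {h = h} h∈I zero = ⁅ h ⁆ , refl , ⁅h⁆⊆I , rank≤
    where
    ⁅h⁆⊆I : ⁅ h ⁆ ⊆ I
    ⁅h⁆⊆I b∈ rewrite x∈⁅y⁆⇒x≡y h b∈ = h∈I
    rank≤ : ∀ {b} → b ∈ ⁅ h ⁆ → rank b ≤ rank h
    rank≤ b∈ rewrite x∈⁅y⁆⇒x≡y h b∈ = ≤-refl
  unfold {h = h} h∈I (suc k) with unfold h∈I k
  ... | X , t , X⊆I , rank≤ = bodies (premises X) , ^-suc-premises k t X⊆I , bodies⊆I , rank≤′
    where
    bodies⊆I : bodies (premises X) ⊆ I
    bodies⊆I b∈ with ∈-bodies-premises⁻ b∈
    ... | a , a∈X , b∈a = body-rule⊆ (X⊆I a∈X) b∈a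
    rank≤′ : ∀ {b} → b ∈ bodies (premises X) → suc k + rank b ≤ rank h
    rank≤′ b∈ with ∈-bodies-premises⁻ b∈
    ... | a , a∈X , b∈a = <-≤-trans (+-monoʳ-< k (rank-body< (X⊆I a∈X) b∈a)) (rank≤ a∈X)

  supported⇒^ω : ∀ {h} → h ∈ I → (⟦ P ⟧ ^ω) (h , Sub.⊥)
  supported⇒^ω {h = h} h∈I with unfold h∈I (suc (rank h))
  ... | X , t , _ , rank≤ = fact∈∘ (fact∈∘ (suc (rank h) , fact))
    where
    X≡⊥ : X ≡ Sub.⊥
    X≡⊥ = Empty-unique λ (b , b∈X) → n≮n (rank h) (m+n≤o⇒m≤o (suc (rank h)) (rank≤ b∈X))
    fact : (⟦ P ⟧ ^ suc (rank h)) (h , Sub.⊥)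
    fact = subst (λ Y → (⟦ P ⟧ ^ suc (rank h)) (h , Y)) X≡⊥ t

applicable? : (I : Subset n) (L : List (Rule n)) →
  (∃ λ r → r ∈ₗ L × body r ⊆ I × head r ∉ I) ⊎ IsModel L I
applicable? I [] = inj₂ λ _ ()
applicable? I (r ∷ L) with body r ⊆? I | head r ∈? I | applicable? I L
... | yes b⊆I | no h∉I | _ = inj₁ (r , here refl , b⊆I , h∉I)
... | _ | _ | inj₁ (r′ , r′∈L , app) = inj₁ (r′ , there r′∈L , app)
... | no b⊈I | _ | inj₂ model = inj₂ λ { _ (here refl) b⊆I → ⊥-elim (b⊈I b⊆I) ; r′ (there r′∈L) → model r′ r′∈L }
... | yes _ | yes h∈I | inj₂ model = inj₂ λ { _ (here refl) _ → h∈I ; r′ (there r′∈L) → model r′ r′∈L }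

module _ {n} (P : FinTheory n) where

  record Stage (k : ℕ) : Set where
    field
      I : Subset n
      support : RankedSupport P I
      rank<k : ∀ {a} → a ∈ I → RankedSupport.rank support a < k
      ⊆-models : ∀ J → IsModel P J → I ⊆ J

  start : Stage 0
  start = record
    { I = Sub.⊥
    ; support = record
      { rule = λ a → a , Sub.⊥ ; rank = λ _ → 0 ; head-rule = λ _ → refl
      ; rule∈P = λ a∈ → ⊥-elim (∉⊥ a∈) ; body-rule⊆ = λ a∈ → ⊥-elim (∉⊥ a∈)
      ; rank-body< = λ a∈ → ⊥-elim (∉⊥ a∈) }
    ; rank<k = λ a∈ → ⊥-elim (∉⊥ a∈)
    ; ⊆-models = λ _ _ → ⊥⊆ }

  delay : ∀ {k} → Stage k → Stage (suc k)
  delay σ = record { I = I ; support = support ; rank<k = λ a∈ → m<n⇒m<1+n (rank<k a∈) ; ⊆-models = ⊆-models }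
    where open Stage σ

  module _ {k} (σ : Stage k) {r} (r∈P : r ∈ₗ P) where
    open Stage σ
    open RankedSupport support

    private
      I′ : Subset n
      I′ = ⁅ head r ⁆ ∪ I

      rule′ : Fin n → Rule n
      rule′ a with a ≟ head r
      ... | yes _ = r
      ... | no _ = rule a

      rank′ : Fin n → ℕ
      rank′ a with a ≟ head r
      ... | yes _ = k
      ... | no _ = rank a

      old : ∀ {a} → a ∈ I′ → a ≢ head r → a ∈ I
      old {a} a∈I′ a≢h with x∈p∪q⁻ ⁅ head r ⁆ I a∈I′
      ... | inj₁ a∈⁅h⁆ = ⊥-elim (a≢h (x∈⁅y⁆⇒x≡y (head r) a∈⁅h⁆))
      ... | inj₂ a∈I = a∈I

    extend : body r ⊆ I → head r ∉ I → Σ (Stage (suc k)) λ σ′ → I ⊂ Stage.I σ′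
    extend body⊆I head∉I = σ′ , q⊆p∪q ⁅ head r ⁆ I , head r , x∈p∪q⁺ (inj₁ (x∈⁅x⁆ (head r))) , head∉I
      where
      rank′-old : ∀ {b} → b ∈ I → rank′ b ≡ rank b
      rank′-old {b} b∈I with b ≟ head r
      ... | yes refl = ⊥-elim (head∉I b∈I)
      ... | no _ = refl

      support′ : RankedSupport P I′
      RankedSupport.rule support′ = rule′
      RankedSupport.rank support′ = rank′
      RankedSupport.head-rule support′ a with a ≟ head r
      ... | yes a≡h = sym a≡h
      ... | no _ = head-rule a
      RankedSupport.rule∈P support′ {a} a∈I′ with a ≟ head r
      ... | yes _ = r∈P
      ... | no a≢h = rule∈P (old a∈I′ a≢h)
      RankedSupport.body-rule⊆ support′ {a} a∈I′ with a ≟ head r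
      ... | yes _ = λ b∈ → q⊆p∪q ⁅ head r ⁆ I (body⊆I b∈)
      ... | no a≢h = λ b∈ → q⊆p∪q ⁅ head r ⁆ I (body-rule⊆ (old a∈I′ a≢h) b∈)
      RankedSupport.rank-body< support′ {a} a∈I′ b∈ with a ≟ head r
      ... | yes _ = subst (_< k) (sym (rank′-old (body⊆I b∈))) (rank<k (body⊆I b∈))
      ... | no a≢h = subst (_< rank a) (sym (rank′-old (body-rule⊆ (old a∈I′ a≢h) b∈)))
                       (rank-body< (old a∈I′ a≢h) b∈)

      rank′<suc-k : ∀ {a} → a ∈ I′ → rank′ a < suc k
      rank′<suc-k {a} a∈I′ with a ≟ head r
      ... | yes _ = ≤-refl
      ... | no a≢h = m<n⇒m<1+n (rank<k (old a∈I′ a≢h))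

      I′⊆models : ∀ J → IsModel P J → I′ ⊆ J
      I′⊆models J model a∈I′ with x∈p∪q⁻ ⁅ head r ⁆ I a∈I′
      ... | inj₁ a∈⁅h⁆ rewrite x∈⁅y⁆⇒x≡y (head r) a∈⁅h⁆ = model r r∈P (λ b∈ → ⊆-models J model (body⊆I b∈))
      ... | inj₂ a∈I = ⊆-models J model a∈I

      σ′ : Stage (suc k)
      σ′ = record { I = I′ ; support = support′ ; rank<k = rank′<suc-k ; ⊆-models = I′⊆models }

  iterate : ∀ k → Σ (Stage k) λ σ → IsModel P (Stage.I σ) ⊎ k ≤ ∣ Stage.I σ ∣
  iterate zero = start , inj₂ z≤n
  iterate (suc k) with iterate k
  ... | σ , inj₁ model = delay σ , inj₁ model
  ... | σ , inj₂ k≤∣I∣ with applicable? (Stage.I σ) P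
  ...   | inj₂ model = delay σ , inj₁ model
  ...   | inj₁ (r , r∈P , body⊆I , head∉I) with extend σ r∈P body⊆I head∉I
  ...     | σ′ , I⊂I′ = σ′ , inj₂ (≤-<-trans k≤∣I∣ (p⊂q⇒∣p∣<∣q∣ I⊂I′))

  leastModel : Σ (Subset n) λ I → IsLeastModel P I × RankedSupport P I
  leastModel with iterate (suc n)
  ... | σ , inj₁ model = I , (model , ⊆-models) , support
    where open Stage σ
  ... | σ , inj₂ n<∣I∣ = ⊥-elim (n≮n n (≤-trans n<∣I∣ (∣p∣≤n (Stage.I σ))))

theorem6p7 : ∀ {n : ℕ} (P : FinTheory n) →
    Σ (Interpretation n) (λ I → IsLeastModel P I)
    × (∀ I → IsLeastModel P I → asTheory I ≐ (⟦ P ⟧ ^ω))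
theorem6p7 P with leastModel P
... | I , isLeast@(model , _) , support = (I , isLeast) , characterisation
  where
  characterisation : ∀ J → IsLeastModel P J → asTheory J ≐ (⟦ P ⟧ ^ω)
  characterisation J (J-model , J-least) _ = mk⇔
    (λ { (h∈J , refl) → supported⇒^ω support (J-least I model h∈J) })
    (^ω-sound J-model)
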